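{- Let $k\in \mathbb{Z}$ and $n, i,j \in \mathbb{Z}^+$ with $n\geq 2$ and $k\not\equiv 0\pmod n$, and let $K_{i,j}$ be the complete bipartite graph with parts of sizes $i$ and $j$. Then \[ \chi_{(n,k)}(K_{i,j}) = \begin{cases} 2, &\text{if } (i,n) \mid k \text{ and } (j,n) \mid k, \\ 3, &\text{if exactly one of } (i,n) \mid k,\ (j,n) \mid k \text{ holds}, \\ 4, &\text{otherwise.} \end{cases}\]
   Context: $(a,b)$ denotes the greatest common divisor. For a graph $G=(V,E)$, a $\mathbb{Z}$-labeling is a map $\ell:V\to\mathbb{Z}$; its order is the size of its range; it is proper if adjacent vertices get different labels. $N(v)$ is the open neighborhood of $v$. An open coloring with remainder $k \bmod n$ is a labeling with $\sum_{w\in N(v)}\ell(w)\equiv k \pmod n$ for all $v\in V$. $\chi_{(n,k)}(G)$ is the minimum order of a proper open coloring with remainder $k\bmod n$ (when one exists). -}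

module Defs where

open import Data.Nat as ℕ using (ℕ; _<ᵇ_)
open import Data.Nat.GCD using (gcd)
open import Data.Integer as ℤ using (ℤ; +_; _-_)
open import Data.Integer.Divisibility using (_∣_)
open import Data.Fin using (Fin; toℕ)
open import Data.List using (List; map; filterᵇ; deduplicate; length; foldr)
open import Data.List.Base using (allFin)
open import Data.Bool using (Bool; true; _xor_)
open import Data.Product using (Σ; _×_)
open import Relation.Binary.PropositionalEquality using (_≡_; _≢_)
open import Relation.Nullary using (¬_)

record Graph : Set where
  field
    size : ℕ
    adj  : Fin size → Fin size → Bool
open Graph public

Labeling : Graph → Set
Labeling G = Fin (size G) → ℤ

vertices : (G : Graph) → List (Fin (size G))
vertices G = allFin (size G)

order : (G : Graph) → Labeling G → ℕ
order G ℓ = length (deduplicate ℤ._≟_ (map ℓ (vertices G)))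

Proper : (G : Graph) → Labeling G → Set
Proper G ℓ = ∀ u v → adj G u v ≡ true → ℓ u ≢ ℓ v

nbhdSum : (G : Graph) → Labeling G → Fin (size G) → ℤ
nbhdSum G ℓ v = foldr ℤ._+_ (+ 0) (map ℓ (filterᵇ (adj G v) (vertices G)))

OpenColoring : (G : Graph) → ℕ → ℤ → Labeling G → Set
OpenColoring G n k ℓ = ∀ v → (+ n) ∣ (nbhdSum G ℓ v - k)

ChiIs : Graph → ℕ → ℤ → ℕ → Set
ChiIs G n k c =
  Σ (Labeling G) (λ ℓ → Proper G ℓ × OpenColoring G n k ℓ × order G ℓ ≡ c)
  × (∀ ℓ → Proper G ℓ → OpenColoring G n k ℓ → c ℕ.≤ order G ℓ)

-- complete bipartite graph K_{i,j}: vertices 0..i-1 form one part, i..i+j-1 the other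
K : ℕ → ℕ → Graph
K i j = record
  { size = i ℕ.+ j
  ; adj  = λ u v → (toℕ u <ᵇ i) xor (toℕ v <ᵇ i) }

{-# OPTIONS --safe #-}
-- In K_{i,j} the neighbourhood of every vertex is the whole opposite side, so a labeling is an
-- open coloring iff the label sum of each side is ≡ k (mod n), and it is proper iff the two sides
-- use disjoint sets of labels.  A side of size m can be monochromatic with label x iff the
-- congruence m x ≡ k (mod n) is solvable, i.e. iff (m,n) ∣ k; otherwise it needs two labels, and
-- two always suffice: one vertex labelled ≡ k and all others ≡ 0.  Every residue class mod n is
-- infinite, so the labels of the second side can be chosen outside those of the first, and
-- χ_(n,k)(K_{i,j}) is the sum of what the two sides need.
module Submission where

open import Defs
open import Data.Bool using (Bool; true; false; not; T; T?)
open import Data.Fin as F using (Fin; toℕ; _↑ˡ_; _↑ʳ_)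
import Data.Fin.Properties as FP
open import Data.Integer as ℤ using (ℤ; +_; -_; _-_; _+_; _*_)
open import Data.Integer.Divisibility using (_∣_)
import Data.Integer.Divisibility.Signed as S
import Data.Integer.Properties as ℤP
open import Data.Integer.Tactic.RingSolver using (solve-∀)
open import Data.List using (List; []; _∷_; _++_; map; filterᵇ; length; foldr; tabulate; applyUpTo)
open import Data.List.Membership.Propositional using (_∈_; _∉_)
open import Data.List.Membership.Propositional.Properties using (∈-map⁺; ∈-map⁻; ∈-allFin; ∈-deduplicate⁺; ∈-deduplicate⁻; ∈-++⁺ˡ; ∈-++⁺ʳ; ∈-++⁻)
import Data.List.Membership.DecPropositional as DecMembership
open import Data.List.Properties using (filter-++; filter-all; filter-none; map-tabulate; tabulate-cong; ++-identityʳ; length-applyUpTo; length-removeAt′; length-++)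
open import Data.List.Relation.Binary.Disjoint.Propositional using (Disjoint)
open import Data.List.Relation.Binary.Subset.Propositional using (_⊆_)
open import Data.List.Relation.Unary.All as All using ([]; _∷_)
open import Data.List.Relation.Unary.All.Properties using (¬All⇒Any¬; tabulate⁺)
open import Data.List.Relation.Unary.AllPairs using (_∷_; [])
open import Data.List.Relation.Unary.Any using (here; there; index; _─_)
open import Data.List.Relation.Unary.Any.Properties using (applyUpTo⁻)
open import Data.List.Relation.Unary.Unique.Propositional using (Unique)
open import Data.List.Relation.Unary.Unique.Propositional.Properties using (applyUpTo⁺₁; ++⁺)
open import Data.List.Relation.Unary.Unique.DecPropositional.Properties ℤ._≟_ using (deduplicate-!)
open import Data.Nat as ℕ using (ℕ; zero; suc; _≤_; _<ᵇ_; z≤n; s≤s; NonZero)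
open import Data.Nat.GCD using (gcd; gcd[m,n]∣m; gcd[m,n]∣n; gcd-GCD; module Bézout)
import Data.Nat.Properties as ℕP
open import Data.Product using (∃; _×_; _,_)
open import Data.Sum using (inj₁; inj₂)
import Data.Vec.Functional as V
open import Data.Vec.Functional.Properties using (lookup-++ˡ; lookup-++ʳ)
open import Function using (_∘_; id)
open import Function.Definitions using (Injective)
open import Relation.Binary.Definitions using (DecidableEquality)
open import Relation.Binary.PropositionalEquality
open import Relation.Nullary using (¬_; yes; no; contradiction)

open import Algebra.Properties.AbelianGroup ℤP.+-0-abelianGroup using (xyx⁻¹≈y; ∙-cancelˡ)

module _ {a} {A : Set a} where

  ∈-─ : ∀ {x y : A} {xs} (y∈xs : y ∈ xs) → x ∈ xs → x ≢ y → x ∈ (xs ─ y∈xs)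
  ∈-─ (here refl) (here refl)  x≢y = contradiction refl x≢y
  ∈-─ (here refl) (there x∈xs) _   = x∈xs
  ∈-─ (there _)   (here refl)  _   = here refl
  ∈-─ (there y∈xs) (there x∈xs) x≢y = there (∈-─ y∈xs x∈xs x≢y)

  unique-⊆⇒length-≤ : ∀ {xs ys : List A} → Unique xs → xs ⊆ ys → length xs ≤ length ys
  unique-⊆⇒length-≤ {[]}     _                  _     = z≤n
  unique-⊆⇒length-≤ {x ∷ xs} {ys} (x∉xs ∷ uniq) xs⊆ys = begin
    suc (length xs)          ≤⟨ s≤s (unique-⊆⇒length-≤ uniq xs⊆ys─x) ⟩
    suc (length (ys ─ x∈ys)) ≡⟨ length-removeAt′ ys (index x∈ys) ⟨
    length ys                ∎
    where
    open ℕP.≤-Reasoning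
    x∈ys : x ∈ ys
    x∈ys = xs⊆ys (here refl)
    xs⊆ys─x : xs ⊆ (ys ─ x∈ys)
    xs⊆ys─x z∈xs = ∈-─ x∈ys (xs⊆ys (there z∈xs)) (All.lookup x∉xs z∈xs ∘ sym)

module _ {a} {A : Set a} (_≟_ : DecidableEquality A) where

  open DecMembership _≟_ using (_∈?_)

  injective-escapes : (g : ℕ → A) → Injective _≡_ _≡_ g → (xs : List A) → ∃ λ t → g t ∉ xs
  injective-escapes g g-inj xs with All.all? (_∈? xs) (applyUpTo g (suc (length xs)))
  ... | no ¬all∈ =
    let t , _ , g[t]∉xs = applyUpTo⁻ g (¬All⇒Any¬ (_∈? xs) _ ¬all∈) in t , g[t]∉xs
  ... | yes all∈ =
    contradiction (subst (_≤ length xs) (length-applyUpTo g _) candidates≤xs) (ℕP.<-irrefl refl)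
    where
    candidates≤xs : length (applyUpTo g (suc (length xs))) ≤ length xs
    candidates≤xs =
      unique-⊆⇒length-≤ (applyUpTo⁺₁ g _ (λ i<j _ → ℕP.<⇒≢ i<j ∘ g-inj)) (All.lookup all∈)

module _ (G : Graph) (ℓ : Labeling G) where

  order≤length : ∀ {xs} → (∀ v → ℓ v ∈ xs) → order G ℓ ≤ length xs
  order≤length {xs} ℓ∈xs =
    unique-⊆⇒length-≤ (deduplicate-! _) (label∈xs ∘ ∈-deduplicate⁻ ℤ._≟_ _)
    where
    label∈xs : map ℓ (vertices G) ⊆ xs
    label∈xs y∈ with v , _ , refl ← ∈-map⁻ ℓ y∈ = ℓ∈xs v

  length≤order : ∀ {xs} → Unique xs → (∀ {x} → x ∈ xs → ∃ λ v → x ≡ ℓ v) →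
                 length xs ≤ order G ℓ
  length≤order uniq labels = unique-⊆⇒length-≤ uniq (∈-deduplicate⁺ ℤ._≟_ ∘ ∈labels)
    where
    ∈labels : ∀ {x} → x ∈ _ → x ∈ map ℓ (vertices G)
    ∈labels x∈xs with v , refl ← labels x∈xs = ∈-map⁺ ℓ (∈-allFin v)

data Side (i j : ℕ) : Fin (i ℕ.+ j) → Set where
  left  : (a : Fin i) → Side i j (a ↑ˡ j)
  right : (b : Fin j) → Side i j (i ↑ʳ b)

side : ∀ i j (v : Fin (i ℕ.+ j)) → Side i j v
side zero    j v         = right v
side (suc i) j F.zero    = left F.zero
side (suc i) j (F.suc v) with side i j v
... | left a  = left (F.suc a)
... | right b = right b

↑ˡ-<ᵇ : ∀ {i} j (a : Fin i) → (toℕ (a ↑ˡ j) <ᵇ i) ≡ true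
↑ˡ-<ᵇ j F.zero    = refl
↑ˡ-<ᵇ j (F.suc a) = ↑ˡ-<ᵇ j a

↑ʳ-≮ᵇ : ∀ i {j} (b : Fin j) → (toℕ (i ↑ʳ b) <ᵇ i) ≡ false
↑ʳ-≮ᵇ zero    b = refl
↑ʳ-≮ᵇ (suc i) b = ↑ʳ-≮ᵇ i b

tabulate-+ : ∀ {A : Set} i {j} (f : Fin (i ℕ.+ j) → A) →
             tabulate f ≡ tabulate (f ∘ (_↑ˡ j)) ++ tabulate (f ∘ (i ↑ʳ_))
tabulate-+ zero    f = refl
tabulate-+ (suc i) f = cong (f F.zero ∷_) (tabulate-+ i (f ∘ F.suc))

∑ : ∀ {m} → (Fin m → ℤ) → ℤ
∑ f = foldr _+_ (+ 0) (tabulate f)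

∑-cong : ∀ {m} {f g : Fin m → ℤ} → (∀ a → f a ≡ g a) → ∑ f ≡ ∑ g
∑-cong = cong (foldr _+_ (+ 0)) ∘ tabulate-cong

∑-const : ∀ m (x : ℤ) → ∑ {m} (λ _ → x) ≡ + m * x
∑-const zero    x = refl
∑-const (suc m) x = trans (cong (_+_ x) (∑-const m x)) (sym (ℤP.suc-* (+ m) x))

module _ {i j : ℕ} where

  K-adj-↑ˡ-↑ʳ : ∀ a b → adj (K i j) (a ↑ˡ j) (i ↑ʳ b) ≡ true
  K-adj-↑ˡ-↑ʳ a b rewrite ↑ˡ-<ᵇ j a | ↑ʳ-≮ᵇ i b = refl

  K-adj-↑ˡ-↑ˡ : ∀ a a′ → adj (K i j) (a ↑ˡ j) (a′ ↑ˡ j) ≡ false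
  K-adj-↑ˡ-↑ˡ a a′ rewrite ↑ˡ-<ᵇ j a | ↑ˡ-<ᵇ j a′ = refl

  K-adj-↑ʳ-↑ʳ : ∀ b b′ → adj (K i j) (i ↑ʳ b) (i ↑ʳ b′) ≡ false
  K-adj-↑ʳ-↑ʳ b b′ rewrite ↑ʳ-≮ᵇ i b | ↑ʳ-≮ᵇ i b′ = refl

  K-neighbours-↑ˡ : ∀ a → filterᵇ (adj (K i j) (a ↑ˡ j)) (vertices (K i j)) ≡ tabulate (i ↑ʳ_)
  K-neighbours-↑ˡ a rewrite ↑ˡ-<ᵇ j a = begin
    filterᵇ p (tabulate id)
      ≡⟨ cong (filterᵇ p) (tabulate-+ i id) ⟩
    filterᵇ p (tabulate (_↑ˡ j) ++ tabulate (i ↑ʳ_))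
      ≡⟨ filter-++ (T? ∘ p) (tabulate (_↑ˡ j)) _ ⟩
    filterᵇ p (tabulate (_↑ˡ j)) ++ filterᵇ p (tabulate (i ↑ʳ_))
      ≡⟨ cong₂ _++_ (filter-none (T? ∘ p) (tabulate⁺ (subst T ∘ cong not ∘ ↑ˡ-<ᵇ {i} j)))
                    (filter-all (T? ∘ p) (tabulate⁺ (λ b → subst T (sym (cong not (↑ʳ-≮ᵇ i b))) _))) ⟩
    tabulate (i ↑ʳ_) ∎
    where
    open ≡-Reasoning
    -- after the rewrite, adjacency to a ↑ˡ j is true xor (toℕ v <ᵇ i), which is p v
    p : Fin (i ℕ.+ j) → Bool
    p v = not (toℕ v <ᵇ i)

  K-neighbours-↑ʳ : ∀ b → filterᵇ (adj (K i j) (i ↑ʳ b)) (vertices (K i j)) ≡ tabulate (_↑ˡ j)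
  K-neighbours-↑ʳ b rewrite ↑ʳ-≮ᵇ i b = begin
    filterᵇ p (tabulate id)
      ≡⟨ cong (filterᵇ p) (tabulate-+ i id) ⟩
    filterᵇ p (tabulate (_↑ˡ j) ++ tabulate (i ↑ʳ_))
      ≡⟨ filter-++ (T? ∘ p) (tabulate (_↑ˡ j)) _ ⟩
    filterᵇ p (tabulate (_↑ˡ j)) ++ filterᵇ p (tabulate (i ↑ʳ_))
      ≡⟨ cong₂ _++_ (filter-all (T? ∘ p) (tabulate⁺ (λ a → subst T (sym (↑ˡ-<ᵇ {i} j a)) _)))
                    (filter-none (T? ∘ p) (tabulate⁺ (subst T ∘ ↑ʳ-≮ᵇ i))) ⟩
    tabulate (_↑ˡ j) ++ []
      ≡⟨ ++-identityʳ _ ⟩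
    tabulate (_↑ˡ j) ∎
    where
    open ≡-Reasoning
    p : Fin (i ℕ.+ j) → Bool
    p v = toℕ v <ᵇ i

  K-proper : (f : Fin i → ℤ) (g : Fin j → ℤ) → (∀ a b → f a ≢ g b) → Proper (K i j) (f V.++ g)
  K-proper f g f≢g u v u~v with side i j u | side i j v
  ... | left a  | left a′  with () ← trans (sym (K-adj-↑ˡ-↑ˡ a a′)) u~v
  ... | right b | right b′ with () ← trans (sym (K-adj-↑ʳ-↑ʳ b b′)) u~v
  ... | left a  | right b  rewrite lookup-++ˡ f g a | lookup-++ʳ f g b = f≢g a b
  ... | right b | left a   rewrite lookup-++ˡ f g a | lookup-++ʳ f g b = f≢g a b ∘ sym

  Proper-K⇒sides-disjoint : ∀ {ℓ} → Proper (K i j) ℓ → ∀ a b → ℓ (a ↑ˡ j) ≢ ℓ (i ↑ʳ b)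
  Proper-K⇒sides-disjoint proper a b = proper _ _ (K-adj-↑ˡ-↑ʳ a b)

module _ {i j : ℕ} (ℓ : Labeling (K i j)) where

  K-nbhdSum-↑ˡ : ∀ a → nbhdSum (K i j) ℓ (a ↑ˡ j) ≡ ∑ (ℓ ∘ (i ↑ʳ_))
  K-nbhdSum-↑ˡ a = cong (foldr _+_ (+ 0))
    (trans (cong (map ℓ) (K-neighbours-↑ˡ a)) (map-tabulate (i ↑ʳ_) ℓ))

  K-nbhdSum-↑ʳ : ∀ b → nbhdSum (K i j) ℓ (i ↑ʳ b) ≡ ∑ (ℓ ∘ (_↑ˡ j))
  K-nbhdSum-↑ʳ b = cong (foldr _+_ (+ 0))
    (trans (cong (map ℓ) (K-neighbours-↑ʳ b)) (map-tabulate (_↑ˡ j) ℓ))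

module _ {i j n : ℕ} {k : ℤ} where

  K-open : (f : Fin i → ℤ) (g : Fin j → ℤ) → (+ n) S.∣ (∑ f - k) → (+ n) S.∣ (∑ g - k) →
           OpenColoring (K i j) n k (f V.++ g)
  K-open f g n∣∑f-k n∣∑g-k v with side i j v
  ... | left a  = S.∣⇒∣ᵤ (subst (λ s → (+ n) S.∣ (s - k))
                    (sym (trans (K-nbhdSum-↑ˡ (f V.++ g) a) (∑-cong (lookup-++ʳ f g)))) n∣∑g-k)
  ... | right b = S.∣⇒∣ᵤ (subst (λ s → (+ n) S.∣ (s - k))
                    (sym (trans (K-nbhdSum-↑ʳ (f V.++ g) b) (∑-cong (lookup-++ˡ f g)))) n∣∑f-k)

  OpenColoring-K⇒∑left≡k : ∀ {ℓ} → OpenColoring (K i j) n k ℓ → Fin j →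
                           (+ n) S.∣ (∑ (ℓ ∘ (_↑ˡ j)) - k)
  OpenColoring-K⇒∑left≡k {ℓ} opn b =
    subst (λ s → (+ n) S.∣ (s - k)) (K-nbhdSum-↑ʳ ℓ b) (S.∣ᵤ⇒∣ (opn (i ↑ʳ b)))

  OpenColoring-K⇒∑right≡k : ∀ {ℓ} → OpenColoring (K i j) n k ℓ → Fin i →
                            (+ n) S.∣ (∑ (ℓ ∘ (i ↑ʳ_)) - k)
  OpenColoring-K⇒∑right≡k {ℓ} opn a =
    subst (λ s → (+ n) S.∣ (s - k)) (K-nbhdSum-↑ˡ ℓ a) (S.∣ᵤ⇒∣ (opn (a ↑ˡ j)))

pos-+-* : ∀ d y n → + (d ℕ.+ y ℕ.* n) ≡ + d + + y * + n
pos-+-* d y n = trans (ℤP.pos-+ d (y ℕ.* n)) (cong (_+_ (+ d)) (ℤP.pos-* y n))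

bézout : ∀ m n → ∃ λ u → (+ n) S.∣ (+ m * u - + gcd m n)
bézout m n with Bézout.identity (gcd-GCD m n)
... | Bézout.+- x y eq = + x , S.divides (+ y) (begin
  + m * + x - + d        ≡⟨ cong (_- + d) (ℤP.*-comm (+ m) (+ x)) ⟩
  + x * + m - + d        ≡⟨ cong (_- + d) (castℤ eq) ⟨
  + d + + y * + n - + d  ≡⟨ xyx⁻¹≈y (+ d) (+ y * + n) ⟩
  + y * + n              ∎)
  where
  open ≡-Reasoning
  d = gcd m n
  castℤ : d ℕ.+ y ℕ.* n ≡ x ℕ.* m → + d + + y * + n ≡ + x * + m
  castℤ eq = trans (sym (pos-+-* d y n)) (trans (cong +_ eq) (ℤP.pos-* x m))
... | Bézout.-+ x y eq = - + x , S.divides (- + y) (begin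
  + m * - + x - + d    ≡⟨ negate-x (+ m) (+ x) (+ d) ⟩
  - (+ d + + x * + m)  ≡⟨ cong -_ (castℤ eq) ⟩
  - (+ y * + n)        ≡⟨ ℤP.neg-distribˡ-* (+ y) (+ n) ⟩
  - + y * + n          ∎)
  where
  open ≡-Reasoning
  d = gcd m n
  castℤ : d ℕ.+ x ℕ.* m ≡ y ℕ.* n → + d + + x * + m ≡ + y * + n
  castℤ eq = trans (sym (pos-+-* d x m)) (trans (cong +_ eq) (ℤP.pos-* y n))
  negate-x : ∀ M X D → M * - X - D ≡ - (D + X * M)
  negate-x = solve-∀

gcd∣⇒congruence-solvable : ∀ m n {k} → (+ gcd m n) ∣ k → ∃ λ x → (+ n) S.∣ (+ m * x - k)
gcd∣⇒congruence-solvable m n {k} gcd∣k with S.∣ᵤ⇒∣ {+ gcd m n} {k} gcd∣k | bézout m n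
... | S.divides q refl | u , n∣mu-d =
  u * q , subst ((+ n) S.∣_) (scale (+ m) u q (+ gcd m n)) (S.∣m⇒∣m*n q n∣mu-d)
  where
  scale : ∀ M U Q D → (M * U - D) * Q ≡ M * (U * Q) - Q * D
  scale = solve-∀

congruence-solvable⇒gcd∣ : ∀ m n {k} x → (+ n) S.∣ (+ m * x - k) → (+ gcd m n) ∣ k
congruence-solvable⇒gcd∣ m n {k} x n∣mx-k =
  S.∣⇒∣ᵤ (subst ((+ gcd m n) S.∣_) (cancel (+ m * x) k) (S.∣m∣n⇒∣m-n gcd∣mx gcd∣mx-k))
  where
  gcd∣mx : (+ gcd m n) S.∣ (+ m * x)
  gcd∣mx = S.∣m⇒∣m*n x (S.∣ᵤ⇒∣ {+ gcd m n} {+ m} (gcd[m,n]∣m m n))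
  gcd∣mx-k : (+ gcd m n) S.∣ (+ m * x - k)
  gcd∣mx-k = S.∣-trans (S.∣ᵤ⇒∣ {+ gcd m n} {+ n} (gcd[m,n]∣n m n)) n∣mx-k
  cancel : ∀ A K → A - (A - K) ≡ K
  cancel = solve-∀

progression-injective : ∀ n .{{_ : NonZero n}} r → Injective _≡_ _≡_ (λ t → r + + n * + t)
progression-injective n r eq = ℤP.+-injective (ℤP.*-cancelˡ-≡ (+ n) _ _ (∙-cancelˡ r _ _ eq))

fresh-in-residue-class : ∀ n .{{_ : NonZero n}} r (xs : List ℤ) →
                         ∃ λ y → (+ n) S.∣ (y - r) × y ∉ xs
fresh-in-residue-class n r xs with injective-escapes ℤ._≟_ _ (progression-injective n r) xs
... | t , y∉xs =
  r + + n * + t , S.divides (+ t) (trans (xyx⁻¹≈y r _) (ℤP.*-comm (+ n) (+ t))) , y∉xs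

data LabelsNeeded (m n : ℕ) (k : ℤ) : ℕ → Set where
  one : (+ gcd m n) ∣ k → LabelsNeeded m n k 1
  two : ¬ (+ gcd m n) ∣ k → LabelsNeeded m n k 2

nonconstant : ∀ {m n k} (f : Fin (suc m) → ℤ) → ¬ (+ gcd (suc m) n) ∣ k →
              (+ n) S.∣ (∑ f - k) → ∃ λ a → f F.zero ≢ f a
nonconstant {m} {n} {k} f gcd∤k n∣∑f-k with FP.all? (λ a → f a ℤ.≟ f F.zero)
... | no ¬constant =
  let a , fa≢f0 = FP.¬∀⟶∃¬ _ _ (λ a → f a ℤ.≟ f F.zero) ¬constant in a , fa≢f0 ∘ sym
... | yes constant = contradiction (congruence-solvable⇒gcd∣ (suc m) n (f F.zero) n∣mf0-k) gcd∤k
  where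
  n∣mf0-k : (+ n) S.∣ (+ suc m * f F.zero - k)
  n∣mf0-k = subst (λ s → (+ n) S.∣ (s - k))
                  (trans (∑-cong constant) (∑-const (suc m) (f F.zero))) n∣∑f-k

distinct-values : ∀ {m n k c} → LabelsNeeded (suc m) n k c →
                  (f : Fin (suc m) → ℤ) → (+ n) S.∣ (∑ f - k) →
                  ∃ λ xs → Unique xs × length xs ≡ c × (∀ {x} → x ∈ xs → ∃ λ a → x ≡ f a)
distinct-values (one _) f _ =
  f F.zero ∷ [] , [] ∷ [] , refl , λ { (here refl) → F.zero , refl ; (there ()) }
distinct-values (two gcd∤k) f n∣∑f-k with a , f0≢fa ← nonconstant f gcd∤k n∣∑f-k =
  f F.zero ∷ f a ∷ [] , (f0≢fa ∷ []) ∷ [] ∷ [] , refl ,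
  λ { (here refl) → F.zero , refl ; (there (here refl)) → a , refl ; (there (there ())) }

K-order-lowerBound : ∀ {i j n k a b} → LabelsNeeded (suc i) n k a → LabelsNeeded (suc j) n k b →
                     ∀ ℓ → Proper (K (suc i) (suc j)) ℓ → OpenColoring (K (suc i) (suc j)) n k ℓ →
                     a ℕ.+ b ≤ order (K (suc i) (suc j)) ℓ
K-order-lowerBound {i} {j} needᵢ needⱼ ℓ proper opn
  with xs , uxs , refl , xs-values ←
         distinct-values needᵢ (ℓ ∘ (_↑ˡ suc j)) (OpenColoring-K⇒∑left≡k {i = suc i} opn F.zero)
     | ys , uys , refl , ys-values ←
         distinct-values needⱼ (ℓ ∘ (suc i ↑ʳ_)) (OpenColoring-K⇒∑right≡k {j = suc j} opn F.zero)
  = subst (_≤ order G ℓ) (length-++ xs) (length≤order G ℓ (++⁺ uxs uys disjoint) labels)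
  where
  G = K (suc i) (suc j)
  disjoint : Disjoint xs ys
  disjoint (x∈xs , x∈ys) with a , refl ← xs-values x∈xs | b , eq ← ys-values x∈ys =
    Proper-K⇒sides-disjoint proper a b eq
  labels : ∀ {x} → x ∈ xs ++ ys → ∃ λ v → x ≡ ℓ v
  labels x∈ with ∈-++⁻ xs x∈
  ... | inj₁ x∈xs = let a , eq = xs-values x∈xs in a ↑ˡ suc j , eq
  ... | inj₂ x∈ys = let b , eq = ys-values x∈ys in suc i ↑ʳ b , eq

record SideLabeling (m n : ℕ) (k : ℤ) (c : ℕ) (avoid : List ℤ) : Set where
  field
    label         : Fin m → ℤ
    palette       : List ℤ
    |palette|≡c   : length palette ≡ c
    label∈palette : ∀ a → label a ∈ palette
    palette-fresh : Disjoint palette avoid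
    n∣∑label-k    : (+ n) S.∣ (∑ label - k)

side-labeling : ∀ {m n k c} .{{_ : NonZero n}} → LabelsNeeded (suc m) n k c → (avoid : List ℤ) →
                SideLabeling (suc m) n k c avoid
side-labeling {m} {n} {k} (one gcd∣k) avoid
  with x , n∣mx-k ← gcd∣⇒congruence-solvable (suc m) n {k} gcd∣k
  with y , n∣y-x , y∉avoid ← fresh-in-residue-class n x avoid
  = record
  { label         = λ _ → y
  ; palette       = y ∷ []
  ; |palette|≡c   = refl
  ; label∈palette = λ _ → here refl
  ; palette-fresh = λ { (here refl , y∈avoid) → y∉avoid y∈avoid ; (there () , _) }
  ; n∣∑label-k    = subst (λ s → (+ n) S.∣ (s - k)) (sym (∑-const (suc m) y)) n∣my-k
  }
  where
  shift : ∀ M X Y K → (M * X - K) + M * (Y - X) ≡ M * Y - K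
  shift = solve-∀
  n∣my-k : (+ n) S.∣ (+ suc m * y - k)
  n∣my-k = subst ((+ n) S.∣_) (shift (+ suc m) x y k)
             (S.∣m∣n⇒∣m+n n∣mx-k (S.∣n⇒∣m*n (+ suc m) n∣y-x))
side-labeling {m} {n} {k} (two _) avoid
  with x , n∣x-k , x∉avoid ← fresh-in-residue-class n k avoid
     | y , n∣y , y∉avoid ← fresh-in-residue-class n (+ 0) avoid
  = record
  { label         = x V.∷ λ _ → y
  ; palette       = x ∷ y ∷ []
  ; |palette|≡c   = refl
  ; label∈palette = λ { F.zero → here refl ; (F.suc _) → there (here refl) }
  ; palette-fresh = λ { (here refl , x∈avoid) → x∉avoid x∈avoid
                      ; (there (here refl) , y∈avoid) → y∉avoid y∈avoid
                      ; (there (there ()) , _) }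
  ; n∣∑label-k    = subst (λ s → (+ n) S.∣ (x + s - k)) (sym (∑-const m y)) n∣x+my-k
  }
  where
  regroup : ∀ X Y M K → (X - K) + M * Y ≡ X + M * Y - K
  regroup = solve-∀
  n∣x+my-k : (+ n) S.∣ (x + + m * y - k)
  n∣x+my-k = subst ((+ n) S.∣_) (regroup x y (+ m) k)
    (S.∣m∣n⇒∣m+n n∣x-k (S.∣n⇒∣m*n (+ m) (subst ((+ n) S.∣_) (ℤP.+-identityʳ y) n∣y)))

K-ChiIs-+ : ∀ {i j n k a b} .{{_ : NonZero n}} →
            LabelsNeeded (suc i) n k a → LabelsNeeded (suc j) n k b →
            ChiIs (K (suc i) (suc j)) n k (a ℕ.+ b)
K-ChiIs-+ {i} {j} {n} {k} {a} {b} needᵢ needⱼ =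
  (ℓ , proper , opn , ℕP.≤-antisym upper (lower ℓ proper opn)) , lower
  where
  open SideLabeling
  G = K (suc i) (suc j)
  A = side-labeling needᵢ []
  B = side-labeling needⱼ (palette A)
  ℓ = label A V.++ label B
  lower = K-order-lowerBound needᵢ needⱼ
  proper : Proper G ℓ
  proper = K-proper (label A) (label B) λ a b eq →
    palette-fresh B (subst (_∈ palette B) (sym eq) (label∈palette B b) , label∈palette A a)
  opn : OpenColoring G n k ℓ
  opn = K-open (label A) (label B) (n∣∑label-k A) (n∣∑label-k B)
  ℓ∈palettes : ∀ v → ℓ v ∈ palette A ++ palette B
  ℓ∈palettes v with side (suc i) (suc j) v
  ... | left a  = subst (_∈ _) (sym (lookup-++ˡ (label A) (label B) a)) (∈-++⁺ˡ (label∈palette A a))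
  ... | right b =
    subst (_∈ _) (sym (lookup-++ʳ (label A) (label B) b)) (∈-++⁺ʳ (palette A) (label∈palette B b))
  |palettes|≡a+b : length (palette A ++ palette B) ≡ a ℕ.+ b
  |palettes|≡a+b = trans (length-++ (palette A)) (cong₂ ℕ._+_ (|palette|≡c A) (|palette|≡c B))
  upper : order G ℓ ≤ a ℕ.+ b
  upper = subst (order G ℓ ≤_) |palettes|≡a+b (order≤length G ℓ ℓ∈palettes)

theorem6p5 : (k : ℤ) (n i j : ℕ) → 2 ≤ n → 1 ≤ i → 1 ≤ j → ¬ ((+ n) ∣ k) →
    ((+ gcd i n) ∣ k → (+ gcd j n) ∣ k → ChiIs (K i j) n k 2)
    × ((+ gcd i n) ∣ k → ¬ ((+ gcd j n) ∣ k) → ChiIs (K i j) n k 3)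
    × (¬ ((+ gcd i n) ∣ k) → (+ gcd j n) ∣ k → ChiIs (K i j) n k 3)
    × (¬ ((+ gcd i n) ∣ k) → ¬ ((+ gcd j n) ∣ k) → ChiIs (K i j) n k 4)
theorem6p5 k (suc n) (suc i) (suc j) _ _ _ _ =
    (λ gᵢ gⱼ → K-ChiIs-+ (one gᵢ) (one gⱼ))
  , (λ gᵢ ¬gⱼ → K-ChiIs-+ (one gᵢ) (two ¬gⱼ))
  , (λ ¬gᵢ gⱼ → K-ChiIs-+ (two ¬gᵢ) (one gⱼ))
  , (λ ¬gᵢ ¬gⱼ → K-ChiIs-+ (two ¬gᵢ) (two ¬gⱼ))
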